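{- Let $j,k$ be integers with $k+250<j<3k/2$, $j\ge 212299$ and $k\ge 141534$. Let $G$ be a complete graph on $4j+1$ vertices whose edges are colored red and blue such that the red subgraph contains no cycle $C_{2k+1}$ and the blue subgraph contains no wheel $W_{2j}$. Let $v$ be a vertex of $G$ of maximum blue degree and let $H$ be the subgraph induced on the blue neighborhood $N^B(v)$. Let $a,b$ be vertices of $H$ joined by a red edge, each having fewer than $j$ blue neighbors in $H$. Let $C$ be a red cycle of length $2j-502$ in $H-a-b$, with vertices labeled by $\mathbb{Z}/(2j-502)\mathbb{Z}$ so that $i$ and $i+1$ are consecutive on $C$. Suppose there is a vertex $c$ of $H$, not on $C$ and distinct from $a,b$, such that the edges $ac$ and $bc$ are red. For each label $i$ set $A_i=1$ if the edge $ai$ is red and $A_i=0$ if blue, and $B_i=1$ if $bi$ is red and $B_i=0$ if blue. Then $|\{x: A_x\neq B_x\}|\le 2000$.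
   Context: $C_m$ is the cycle of length $m$; the wheel $W_{n}$ consists of a cycle $C_n$ together with a hub vertex adjacent to all cycle vertices. Indices of labels are taken modulo $2j-502$. -}

module Defs where

open import Data.Nat as ℕ using (ℕ; zero; suc; _+_)
open import Data.Nat.Properties using (suc-injective)
open import Data.Fin as Fin using (Fin; zero; suc; toℕ; lower₁)
open import Data.Bool using (Bool; true; false)
open import Data.Product using (_×_; Σ)
open import Relation.Nullary using (¬_; yes; no)
open import Relation.Binary.PropositionalEquality using (_≡_; _≢_; sym)
open import Function.Definitions using (Injective)

data Colour : Set where
  red blue : Colour

-- An edge 2-colouring of the complete graph on vertex set Fin n:
-- a symmetric function on pairs (diagonal values are never consulted).
record Colouring (n : ℕ) : Set where
  field
    col  : Fin n → Fin n → Colour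
    symm : ∀ x y → col x y ≡ col y x
open Colouring public

cycSuc : ∀ {m} → Fin m → Fin m
cycSuc {suc m} i with toℕ i ℕ.≟ m
... | yes _ = zero
... | no ne = lower₁ (suc i) (λ eq → ne (sym (suc-injective eq)))

count : ∀ {m} → (Fin m → Bool) → ℕ
count {zero} p = 0
count {suc m} p with p zero
... | true  = suc (count (λ i → p (suc i)))
... | false = count (λ i → p (suc i))

isBlue : Colour → Bool
isBlue red  = false
isBlue blue = true

differ : Colour → Colour → Bool
differ red  red  = false
differ blue blue = false
differ _    _    = true

neq : ∀ {n} → Fin n → Fin n → Bool
neq x y with x Fin.≟ y
... | yes _ = false
... | no _  = true

_∧_ : Bool → Bool → Bool
true ∧ b = b
false ∧ _ = false

module _ {n : ℕ} (G : Colouring n) where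

  IsCycle : Colour → (m : ℕ) → (Fin m → Fin n) → Set
  IsCycle χ m f = Injective _≡_ _≡_ f × (∀ i → col G (f i) (f (cycSuc i)) ≡ χ)

  HasCycle : Colour → ℕ → Set
  HasCycle χ m = Σ (Fin m → Fin n) (IsCycle χ m)

  HasWheel : Colour → ℕ → Set
  HasWheel χ m = Σ (Fin n) λ h → Σ (Fin m → Fin n) λ f →
    IsCycle χ m f × (∀ i → f i ≢ h) × (∀ i → col G h (f i) ≡ χ)

  blueAdj : Fin n → Fin n → Bool
  blueAdj v u = neq v u ∧ isBlue (col G v u)

  blueDeg : Fin n → ℕ
  blueDeg v = count (blueAdj v)

  blueDegIn : Fin n → Fin n → ℕ
  blueDegIn v a = count (λ u → blueAdj v u ∧ blueAdj a u)

-- Let A i, B i indicate that a, respectively b, is joined in red to C i, indices taken modulo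
-- N = 2j − 502, and put d = 2k − 3. Since there is no red C_{2k+1}, no i has A i together with
-- A (i+d+2), B (i+d+1) or B (i+d): otherwise a red arc of C from C i closes up into such a cycle
-- through a, through b a, or through b c a. These exclusions give the pointwise bounds
--   [A i ≠ A (i+1)] + A i + A (i+1) + 2 B (i+d+1) ≤ 2,
--   [A (i+d+2) ≠ B (i+d+1)] + A (i+d+2) + B (i+d+1) + 2 A i ≤ 2,
-- and summing them over the cycle, with [A i ≠ B i] ≤ [A i ≠ A (i+1)] + [A (i+1) ≠ B i], yields
-- #{A ≠ B} + 5 ΣA + 3 ΣB ≤ 4N. As a and b have fewer than j blue neighbours in H, ΣA and ΣB
-- exceed N − j, whence #{A ≠ B} ≤ 8 (j − 1) − 4N = 2000.

module Submission where

open import Defs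
open import Algebra.Properties.CommutativeMonoid.Sum using ()
open import Algebra.Properties.Semiring.Sum using ()
open import Data.Bool using (Bool; true; false; not; _xor_)
open import Data.Empty using (⊥; ⊥-elim)
open import Data.Fin as Fin using (Fin; zero; suc; toℕ; fromℕ; inject₁; punchOut)
open import Data.Fin.Properties
  using ( toℕ-injective; toℕ<n; toℕ-fromℕ; toℕ-lower₁; toℕ-inject₁
        ; punchOut-injective; punchIn-punchOut)
  renaming (suc-injective to Fin-suc-injective)
open import Data.Nat using (ℕ; zero; suc; _+_; _*_; _∸_; _<_; _≤_; _≥_; z≤n; s≤s; NonZero)
open import Data.Nat.DivMod using (_%_; m<n⇒m%n≡m; n%n≡0; [m+n]%n≡m%n; %-distribˡ-+; m%n%n≡m%n)
open import Data.Nat.Properties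
open import Data.Nat.Tactic.RingSolver using (solve-∀)
open import Data.Product using (_×_; _,_; ∃; proj₁)
open import Data.Sum using (_⊎_; inj₁; inj₂)
open import Data.Vec.Functional using (Vector; _∷_; removeAt)
open import Function using (_∘_; flip)
open import Function.Definitions using (Injective)
open import Relation.Nullary using (¬_; yes; no)
open import Relation.Binary.PropositionalEquality
  using (_≡_; _≢_; refl; sym; trans; cong; cong₂; subst; module ≡-Reasoning)

open Algebra.Properties.CommutativeMonoid.Sum +-0-commutativeMonoid
  using (sum; sum-cong-≗; sum-init-last; sum-remove; ∑-distrib-+)
open Algebra.Properties.Semiring.Sum +-*-semiring using (*-distribˡ-sum)

𝟙 : Bool → ℕ
𝟙 true  = 1
𝟙 false = 0

sum-const : ∀ n c → sum {n} (λ _ → c) ≡ n * c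
sum-const zero    c = refl
sum-const (suc n) c = cong (c +_) (sum-const n c)

sum-mono-≤ : ∀ {n} {f g : Vector ℕ n} → (∀ i → f i ≤ g i) → sum f ≤ sum g
sum-mono-≤ {zero}  f≤g = z≤n
sum-mono-≤ {suc n} f≤g = +-mono-≤ (f≤g zero) (sum-mono-≤ (f≤g ∘ suc))

sum-inject-≤ : ∀ {m n} (f : Fin m → Fin n) → Injective _≡_ _≡_ f → (g : Vector ℕ n) →
  sum (g ∘ f) ≤ sum g
sum-inject-≤ {zero}          f f-inj g = z≤n
sum-inject-≤ {suc m} {zero}  f f-inj g with () ← f zero
sum-inject-≤ {suc m} {suc n} f f-inj g = begin
  g (f zero) + sum (g ∘ f ∘ suc)
    ≡⟨ cong (g (f zero) +_) (sum-cong-≗ (λ i → cong g (sym (punchIn-punchOut (f₀≢ i))))) ⟩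
  g (f zero) + sum (removeAt g (f zero) ∘ f′)
    ≤⟨ +-monoʳ-≤ (g (f zero)) (sum-inject-≤ f′ f′-inj (removeAt g (f zero))) ⟩
  g (f zero) + sum (removeAt g (f zero))
    ≡⟨ sum-remove {i = f zero} g ⟨
  sum g ∎
  where
  open ≤-Reasoning
  f₀≢ : ∀ i → f zero ≢ f (suc i)
  f₀≢ i eq with () ← f-inj eq
  f′ : Fin m → Fin n
  f′ i = punchOut (f₀≢ i)
  f′-inj : Injective _≡_ _≡_ f′
  f′-inj {i} {i′} eq = Fin-suc-injective (f-inj (punchOut-injective (f₀≢ i) (f₀≢ i′) eq))

count≡sum : ∀ {n} (p : Fin n → Bool) → count p ≡ sum (𝟙 ∘ p)
count≡sum {zero}  p = refl
count≡sum {suc n} p with p zero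
... | true  = cong suc (count≡sum (p ∘ suc))
... | false = count≡sum (p ∘ suc)

sum-𝟙+sum-𝟙-not : ∀ {n} (p : Fin n → Bool) → sum (𝟙 ∘ p) + sum (𝟙 ∘ not ∘ p) ≡ n
sum-𝟙+sum-𝟙-not {n} p = begin
  sum (𝟙 ∘ p) + sum (𝟙 ∘ not ∘ p)      ≡⟨ ∑-distrib-+ (𝟙 ∘ p) (𝟙 ∘ not ∘ p) ⟨
  sum (λ i → 𝟙 (p i) + 𝟙 (not (p i))) ≡⟨ sum-cong-≗ (𝟙+𝟙-not ∘ p) ⟩
  sum {n} (λ _ → 1)                    ≡⟨ sum-const n 1 ⟩
  n * 1                                ≡⟨ *-identityʳ n ⟩
  n                                    ∎
  where
  open ≡-Reasoning
  𝟙+𝟙-not : ∀ b → 𝟙 b + 𝟙 (not b) ≡ 1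
  𝟙+𝟙-not true  = refl
  𝟙+𝟙-not false = refl

[m+n%d]%d≡[m+n]%d : ∀ m n d .{{_ : NonZero d}} → (m + n % d) % d ≡ (m + n) % d
[m+n%d]%d≡[m+n]%d m n d = begin
  (m + n % d) % d           ≡⟨ %-distribˡ-+ m (n % d) d ⟩
  (m % d + n % d % d) % d   ≡⟨ cong (λ x → (m % d + x) % d) (m%n%n≡m%n n d) ⟩
  (m % d + n % d) % d       ≡⟨ %-distribˡ-+ m n d ⟨
  (m + n) % d               ∎
  where open ≡-Reasoning

+-%-cancelˡ : ∀ x {s t d} .{{_ : NonZero d}} → x ≤ d → s < d → t < d →
  (x + s) % d ≡ (x + t) % d → s ≡ t
+-%-cancelˡ x {s} {t} {d} x≤d s<d t<d eq = begin
  s                           ≡⟨ undo s<d ⟨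
  (d ∸ x + (x + s) % d) % d   ≡⟨ cong (λ y → (d ∸ x + y) % d) eq ⟩
  (d ∸ x + (x + t) % d) % d   ≡⟨ undo t<d ⟩
  t                           ∎
  where
  open ≡-Reasoning
  undo : ∀ {u} → u < d → (d ∸ x + (x + u) % d) % d ≡ u
  undo {u} u<d = begin
    (d ∸ x + (x + u) % d) % d   ≡⟨ [m+n%d]%d≡[m+n]%d (d ∸ x) (x + u) d ⟩
    (d ∸ x + (x + u)) % d       ≡⟨ cong (_% d) (+-assoc (d ∸ x) x u) ⟨
    (d ∸ x + x + u) % d         ≡⟨ cong (λ y → (y + u) % d) (m∸n+n≡m x≤d) ⟩
    (d + u) % d                 ≡⟨ cong (_% d) (+-comm d u) ⟩
    (u + d) % d                 ≡⟨ [m+n]%n≡m%n u d ⟩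
    u % d                       ≡⟨ m<n⇒m%n≡m u<d ⟩
    u                           ∎

toℕ-cycSuc : ∀ {m} (i : Fin (suc m)) → toℕ (cycSuc i) ≡ suc (toℕ i) % suc m
toℕ-cycSuc {m} i with toℕ i Data.Nat.≟ m
... | yes i≡m = sym (trans (cong (λ x → suc x % suc m) i≡m) (n%n≡0 (suc m)))
... | no  i≢m = trans (toℕ-lower₁ (suc i) (λ eq → i≢m (sym (suc-injective eq))))
                      (sym (m<n⇒m%n≡m (s≤s (≤∧≢⇒< (≤-pred (toℕ<n i)) i≢m))))

cycSuc-inject₁ : ∀ {m} (i : Fin m) → cycSuc (inject₁ i) ≡ suc i
cycSuc-inject₁ {m} i = toℕ-injective (begin
  toℕ (cycSuc (inject₁ i))         ≡⟨ toℕ-cycSuc (inject₁ i) ⟩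
  suc (toℕ (inject₁ i)) % suc m    ≡⟨ cong (λ x → suc x % suc m) (toℕ-inject₁ i) ⟩
  suc (toℕ i) % suc m              ≡⟨ m<n⇒m%n≡m (s≤s (toℕ<n i)) ⟩
  suc (toℕ i)                      ∎)
  where open ≡-Reasoning

cycSuc-fromℕ : ∀ m → cycSuc (fromℕ m) ≡ zero
cycSuc-fromℕ m = toℕ-injective (begin
  toℕ (cycSuc (fromℕ m))        ≡⟨ toℕ-cycSuc (fromℕ m) ⟩
  suc (toℕ (fromℕ m)) % suc m   ≡⟨ cong (λ x → suc x % suc m) (toℕ-fromℕ m) ⟩
  suc m % suc m                 ≡⟨ n%n≡0 (suc m) ⟩
  0                             ∎)
  where open ≡-Reasoning

sum-cycSuc : ∀ {n} (f : Vector ℕ n) → sum (f ∘ cycSuc) ≡ sum f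
sum-cycSuc {zero}  f = refl
sum-cycSuc {suc m} f = begin
  sum (f ∘ cycSuc)
    ≡⟨ sum-init-last (f ∘ cycSuc) ⟩
  sum (f ∘ cycSuc ∘ inject₁) + f (cycSuc (fromℕ m))
    ≡⟨ cong₂ _+_ (sum-cong-≗ (cong f ∘ cycSuc-inject₁)) (cong f (cycSuc-fromℕ m)) ⟩
  sum (f ∘ suc) + f zero
    ≡⟨ +-comm (sum (f ∘ suc)) (f zero) ⟩
  sum f ∎
  where open ≡-Reasoning

rotate : ∀ {n} → ℕ → Fin n → Fin n
rotate zero    i = i
rotate (suc t) i = cycSuc (rotate t i)

rotate-suc : ∀ {n} t (i : Fin n) → rotate (suc t) i ≡ rotate t (cycSuc i)
rotate-suc zero    i = refl
rotate-suc (suc t) i = cong cycSuc (rotate-suc t i)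

sum-rotate : ∀ {n} t (f : Vector ℕ n) → sum (f ∘ rotate t) ≡ sum f
sum-rotate zero    f = refl
sum-rotate (suc t) f = trans (sum-rotate t (f ∘ cycSuc)) (sum-cycSuc f)

toℕ-rotate : ∀ {m} t (i : Fin (suc m)) → toℕ (rotate t i) ≡ (toℕ i + t) % suc m
toℕ-rotate {m} zero i = begin
  toℕ i                ≡⟨ m<n⇒m%n≡m (toℕ<n i) ⟨
  toℕ i % suc m        ≡⟨ cong (_% suc m) (+-identityʳ (toℕ i)) ⟨
  (toℕ i + 0) % suc m  ∎
  where open ≡-Reasoning
toℕ-rotate {m} (suc t) i = begin
  toℕ (cycSuc (rotate t i))             ≡⟨ toℕ-cycSuc (rotate t i) ⟩
  suc (toℕ (rotate t i)) % suc m        ≡⟨ cong (λ x → suc x % suc m) (toℕ-rotate t i) ⟩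
  (1 + (toℕ i + t) % suc m) % suc m     ≡⟨ [m+n%d]%d≡[m+n]%d 1 (toℕ i + t) (suc m) ⟩
  suc (toℕ i + t) % suc m               ≡⟨ cong (_% suc m) (+-suc (toℕ i) t) ⟨
  (toℕ i + suc t) % suc m               ∎
  where open ≡-Reasoning

rotate-injective : ∀ {m} (i : Fin (suc m)) {s t} → s < suc m → t < suc m →
  rotate s i ≡ rotate t i → s ≡ t
rotate-injective i {s} {t} s<m t<m eq = +-%-cancelˡ (toℕ i) (<⇒≤ (toℕ<n i)) s<m t<m (begin
  (toℕ i + s) % _   ≡⟨ toℕ-rotate s i ⟨
  toℕ (rotate s i)  ≡⟨ cong toℕ eq ⟩
  toℕ (rotate t i)  ≡⟨ toℕ-rotate t i ⟩
  (toℕ i + t) % _   ∎)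
  where open ≡-Reasoning

fromℕ⊎inject₁ : ∀ {m} (i : Fin (suc m)) → i ≡ fromℕ m ⊎ ∃ λ t → i ≡ inject₁ t
fromℕ⊎inject₁ {zero}  zero    = inj₁ refl
fromℕ⊎inject₁ {suc m} zero    = inj₂ (zero , refl)
fromℕ⊎inject₁ {suc m} (suc i) with fromℕ⊎inject₁ i
... | inj₁ i≡last      = inj₁ (cong suc i≡last)
... | inj₂ (t , i≡t)   = inj₂ (suc t , cong suc i≡t)

arc : ∀ {A : Set} {N} → Vector A N → Fin N → (L : ℕ) → Vector A (suc L)
arc C i L t = C (rotate (toℕ t) i)

arc-last : ∀ {A : Set} {N} (C : Vector A N) i L → arc C i L (fromℕ L) ≡ C (rotate L i)
arc-last C i L = cong (λ t → C (rotate t i)) (toℕ-fromℕ L)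

module _ {n} (G : Colouring n) (χ : Colour) where

  IsPath : (ℓ : ℕ) → Vector (Fin n) (suc ℓ) → Set
  IsPath ℓ p = Injective _≡_ _≡_ p × (∀ t → col G (p (inject₁ t)) (p (suc t)) ≡ χ)

  path-∷ : ∀ {ℓ p} x → IsPath ℓ p → col G x (p zero) ≡ χ → (∀ t → x ≢ p t) →
    IsPath (suc ℓ) (x ∷ p)
  path-∷ {p = p} x (p-inj , p-edge) x-p₀ x∉p = inj , edge
    where
    inj : Injective _≡_ _≡_ (x ∷ p)
    inj {zero}  {zero}  _  = refl
    inj {zero}  {suc t} eq = ⊥-elim (x∉p t eq)
    inj {suc s} {zero}  eq = ⊥-elim (x∉p s (sym eq))
    inj {suc s} {suc t} eq = cong suc (p-inj eq)
    edge : ∀ t → col G ((x ∷ p) (inject₁ t)) ((x ∷ p) (suc t)) ≡ χ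
    edge zero    = x-p₀
    edge (suc t) = p-edge t

  path⇒cycle : ∀ {ℓ p} → IsPath ℓ p → col G (p (fromℕ ℓ)) (p zero) ≡ χ → IsCycle G χ (suc ℓ) p
  path⇒cycle {ℓ} {p} (p-inj , p-edge) closing = p-inj , edge
    where
    edge : ∀ i → col G (p i) (p (cycSuc i)) ≡ χ
    edge i with fromℕ⊎inject₁ i
    ... | inj₁ refl       rewrite cycSuc-fromℕ ℓ   = closing
    ... | inj₂ (t , refl) rewrite cycSuc-inject₁ t = p-edge t

  arc-path : ∀ {N C} → IsCycle G χ N C → (i : Fin N) {L : ℕ} → L < N → IsPath L (arc C i L)
  arc-path {suc m} {C} (C-inj , C-edge) i {L} L<N = inj , edge
    where
    inj : Injective _≡_ _≡_ (arc C i L)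
    inj {s} {t} eq = toℕ-injective
      (rotate-injective i (≤-trans (toℕ<n s) L<N) (≤-trans (toℕ<n t) L<N) (C-inj eq))
    edge : ∀ t → col G (arc C i L (inject₁ t)) (arc C i L (suc t)) ≡ χ
    edge t rewrite toℕ-inject₁ t = C-edge (rotate (toℕ t) i)

xor-triangle : ∀ x y z → 𝟙 (x xor z) ≤ 𝟙 (x xor y) + 𝟙 (y xor z)
xor-triangle true  true  z     = ≤-refl
xor-triangle false false z     = ≤-refl
xor-triangle true  false true  = z≤n
xor-triangle true  false false = ≤-refl
xor-triangle false true  true  = ≤-refl
xor-triangle false true  false = z≤n

xor-weight : ∀ x y w → (x ≡ true → w ≡ true → ⊥) → (y ≡ true → w ≡ true → ⊥) →
  𝟙 (x xor y) + 𝟙 x + 𝟙 y + 2 * 𝟙 w ≤ 2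
xor-weight true  _     true  x⊼w _   = ⊥-elim (x⊼w refl refl)
xor-weight false true  true  _   y⊼w = ⊥-elim (y⊼w refl refl)
xor-weight false false true  _   _   = ≤-refl
xor-weight true  true  false _   _   = ≤-refl
xor-weight true  false false _   _   = ≤-refl
xor-weight false true  false _   _   = ≤-refl
xor-weight false false false _   _   = z≤n

sum-weights : ∀ {n} (f g h w : Vector ℕ n) →
  sum (λ i → f i + g i + h i + 2 * w i) ≡ sum f + sum g + sum h + 2 * sum w
sum-weights f g h w = begin
  sum (λ i → f i + g i + h i + 2 * w i)
    ≡⟨ ∑-distrib-+ (λ i → f i + g i + h i) (λ i → 2 * w i) ⟩
  sum (λ i → f i + g i + h i) + sum (λ i → 2 * w i)
    ≡⟨ cong₂ _+_ (trans (∑-distrib-+ (λ i → f i + g i) h) (cong (_+ sum h) (∑-distrib-+ f g)))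
                 (sym (*-distribˡ-sum 2 w)) ⟩
  sum f + sum g + sum h + 2 * sum w ∎
  where open ≡-Reasoning

module _ {N} (A B : Fin N → Bool) (d : ℕ)
  (A-A : ∀ i → A i ≡ true → A (rotate (2 + d) i) ≡ true → ⊥)
  (A-B₁ : ∀ i → A i ≡ true → B (rotate (1 + d) i) ≡ true → ⊥)
  (A-B₀ : ∀ i → A i ≡ true → B (rotate d i) ≡ true → ⊥) where

  private
    a b D₁ D₂ : ℕ
    a  = sum (𝟙 ∘ A)
    b  = sum (𝟙 ∘ B)
    D₁ = sum (λ i → 𝟙 (A i xor A (cycSuc i)))
    D₂ = sum (λ i → 𝟙 (A (cycSuc i) xor B i))

    D₁-bound : D₁ + a + a + 2 * b ≤ N * 2
    D₁-bound = begin
      D₁ + a + a + 2 * b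
        ≡⟨ cong₂ (λ x y → D₁ + a + x + 2 * y) (sum-cycSuc (𝟙 ∘ A)) (sum-rotate (1 + d) (𝟙 ∘ B)) ⟨
      D₁ + a + sum Aₛ + 2 * sum Bᵣ
        ≡⟨ sum-weights xorₛ (𝟙 ∘ A) Aₛ Bᵣ ⟨
      sum (λ i → xorₛ i + 𝟙 (A i) + Aₛ i + 2 * Bᵣ i)
        ≤⟨ sum-mono-≤ (λ i → xor-weight _ _ _ (A-B₁ i) (A-B₀′ i)) ⟩
      sum {N} (λ _ → 2)
        ≡⟨ sum-const N 2 ⟩
      N * 2 ∎
      where
      open ≤-Reasoning
      xorₛ Aₛ Bᵣ : Vector ℕ N
      xorₛ i = 𝟙 (A i xor A (cycSuc i))
      Aₛ i = 𝟙 (A (cycSuc i))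
      Bᵣ i = 𝟙 (B (rotate (1 + d) i))
      A-B₀′ : ∀ i → A (cycSuc i) ≡ true → B (rotate (1 + d) i) ≡ true → ⊥
      A-B₀′ i Aᵢ₊₁ Bⱼ = A-B₀ (cycSuc i) Aᵢ₊₁ (subst (λ j → B j ≡ true) (rotate-suc d i) Bⱼ)

    D₂-bound : D₂ + a + b + 2 * a ≤ N * 2
    D₂-bound = begin
      D₂ + a + b + 2 * a
        ≡⟨ cong₂ (λ x y → x + y + b + 2 * a) (sum-rotate (1 + d) (λ i → 𝟙 (A (cycSuc i) xor B i)))
                                             (sum-rotate (2 + d) (𝟙 ∘ A)) ⟨
      sum xorᵣ + sum Aᵣ + b + 2 * a
        ≡⟨ cong (λ x → sum xorᵣ + sum Aᵣ + x + 2 * a) (sum-rotate (1 + d) (𝟙 ∘ B)) ⟨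
      sum xorᵣ + sum Aᵣ + sum Bᵣ + 2 * a
        ≡⟨ sum-weights xorᵣ Aᵣ Bᵣ (𝟙 ∘ A) ⟨
      sum (λ i → xorᵣ i + Aᵣ i + Bᵣ i + 2 * 𝟙 (A i))
        ≤⟨ sum-mono-≤ (λ i → xor-weight _ _ _ (flip (A-A i)) (flip (A-B₁ i))) ⟩
      sum {N} (λ _ → 2)
        ≡⟨ sum-const N 2 ⟩
      N * 2 ∎
      where
      open ≤-Reasoning
      xorᵣ Aᵣ Bᵣ : Vector ℕ N
      xorᵣ i = 𝟙 (A (rotate (2 + d) i) xor B (rotate (1 + d) i))
      Aᵣ i = 𝟙 (A (rotate (2 + d) i))
      Bᵣ i = 𝟙 (B (rotate (1 + d) i))

  sum-xor+5A+3B≤4N : sum (λ i → 𝟙 (A i xor B i)) + 5 * sum (𝟙 ∘ A) + 3 * sum (𝟙 ∘ B) ≤ 4 * N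
  sum-xor+5A+3B≤4N = begin
    sum (λ i → 𝟙 (A i xor B i)) + 5 * a + 3 * b
      ≤⟨ +-monoˡ-≤ (3 * b) (+-monoˡ-≤ (5 * a) triangle) ⟩
    D₁ + D₂ + 5 * a + 3 * b
      ≡⟨ regroup D₁ D₂ a b ⟩
    (D₁ + a + a + 2 * b) + (D₂ + a + b + 2 * a)
      ≤⟨ +-mono-≤ D₁-bound D₂-bound ⟩
    N * 2 + N * 2
      ≡⟨ double N ⟩
    4 * N ∎
    where
    open ≤-Reasoning
    triangle : sum (λ i → 𝟙 (A i xor B i)) ≤ D₁ + D₂
    triangle = ≤-trans (sum-mono-≤ (λ i → xor-triangle (A i) (A (cycSuc i)) (B i)))
                       (≤-reflexive (∑-distrib-+ (λ i → 𝟙 (A i xor A (cycSuc i)))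
                                                      (λ i → 𝟙 (A (cycSuc i) xor B i))))
    regroup : ∀ x y u v → x + y + 5 * u + 3 * v ≡ (x + u + u + 2 * v) + (y + u + v + 2 * u)
    regroup = solve-∀
    double : ∀ x → x * 2 + x * 2 ≡ 4 * x
    double = solve-∀

isRed : Colour → Bool
isRed red  = true
isRed blue = false

isRed⇒≡red : ∀ {c} → isRed c ≡ true → c ≡ red
isRed⇒≡red {red} _ = refl

not-isRed : ∀ c → not (isRed c) ≡ isBlue c
not-isRed red  = refl
not-isRed blue = refl

differ≡xor : ∀ c c′ → differ c c′ ≡ isRed c xor isRed c′
differ≡xor red  red  = refl
differ≡xor red  blue = refl
differ≡xor blue red  = refl
differ≡xor blue blue = refl

neq-≢ : ∀ {n} {x y : Fin n} → x ≢ y → neq x y ≡ true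
neq-≢ {x = x} {y} x≢y with x Fin.≟ y
... | yes x≡y = ⊥-elim (x≢y x≡y)
... | no  _   = refl

sum-blue-≤-blueDegIn : ∀ {m n} (G : Colouring n) (v x : Fin n) (f : Fin m → Fin n) →
  Injective _≡_ _≡_ f → (∀ i → blueAdj G v (f i) ≡ true) → (∀ i → f i ≢ x) →
  sum (λ i → 𝟙 (isBlue (col G x (f i)))) ≤ blueDegIn G v x
sum-blue-≤-blueDegIn {n = n} G v x f f-inj f⊆H f∌x = begin
  sum (λ i → 𝟙 (isBlue (col G x (f i))))  ≡⟨ sum-cong-≗ (cong 𝟙 ∘ inH-f) ⟩
  sum (𝟙 ∘ inH ∘ f)                       ≤⟨ sum-inject-≤ f f-inj (𝟙 ∘ inH) ⟩
  sum (𝟙 ∘ inH)                           ≡⟨ count≡sum inH ⟨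
  blueDegIn G v x                          ∎
  where
  open ≤-Reasoning
  inH : Fin n → Bool
  inH u = blueAdj G v u ∧ blueAdj G x u
  inH-f : ∀ i → isBlue (col G x (f i)) ≡ inH (f i)
  inH-f i rewrite f⊆H i | neq-≢ (f∌x i ∘ sym) = refl

module OffCycleTriangle {n N} (G : Colouring n) (d : ℕ) (no-cycle : ¬ HasCycle G red (4 + d))
  {C : Vector (Fin n) N} (C-cycle : IsCycle G red N C) (d+2<N : 2 + d < N)
  {a b c : Fin n} (C∌a : ∀ i → C i ≢ a) (C∌b : ∀ i → C i ≢ b) (C∌c : ∀ i → C i ≢ c)
  (a≢b : a ≢ b) (c≢a : c ≢ a) (c≢b : c ≢ b)
  (ab : col G a b ≡ red) (ac : col G a c ≡ red) (bc : col G b c ≡ red) where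

  A B : Fin N → Bool
  A i = isRed (col G a (C i))
  B i = isRed (col G b (C i))

  private
    short-arc : ∀ i L → L ≤ 2 + d → IsPath G red L (arc C i L)
    short-arc i L L≤2+d = arc-path G red C-cycle i (≤-<-trans L≤2+d d+2<N)

    off-arc : ∀ {x} → (∀ i → C i ≢ x) → ∀ {i L} t → x ≢ arc C i L t
    off-arc C∌x t eq = C∌x _ (sym eq)

    avoid-∷ : ∀ {x y m} {p : Vector (Fin n) m} → x ≢ y → (∀ t → x ≢ p t) → ∀ t → x ≢ (y ∷ p) t
    avoid-∷ x≢y _   zero    = x≢y
    avoid-∷ _   x∉p (suc t) = x∉p t

    closing : ∀ {x} i L → isRed (col G x (C (rotate L i))) ≡ true →
      col G (arc C i L (fromℕ L)) x ≡ red
    closing {x} i L x~Cⱼ rewrite arc-last C i L = trans (symm G _ x) (isRed⇒≡red x~Cⱼ)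

  A-A-apart : ∀ i → A i ≡ true → A (rotate (2 + d) i) ≡ true → ⊥
  A-A-apart i Aᵢ Aⱼ = no-cycle (_ , path⇒cycle G red
    (path-∷ G red a (short-arc i (2 + d) ≤-refl) (isRed⇒≡red Aᵢ) (off-arc C∌a))
    (closing i (2 + d) Aⱼ))

  A-B-apart₁ : ∀ i → A i ≡ true → B (rotate (1 + d) i) ≡ true → ⊥
  A-B-apart₁ i Aᵢ Bⱼ = no-cycle (_ , path⇒cycle G red
    (path-∷ G red b
      (path-∷ G red a (short-arc i (1 + d) (n≤1+n _)) (isRed⇒≡red Aᵢ) (off-arc C∌a))
      (trans (symm G b a) ab) (avoid-∷ (a≢b ∘ sym) (off-arc C∌b)))
    (closing i (1 + d) Bⱼ))

  A-B-apart₀ : ∀ i → A i ≡ true → B (rotate d i) ≡ true → ⊥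
  A-B-apart₀ i Aᵢ Bⱼ = no-cycle (_ , path⇒cycle G red
    (path-∷ G red b
      (path-∷ G red c
        (path-∷ G red a (short-arc i d (m≤n+m d 2)) (isRed⇒≡red Aᵢ) (off-arc C∌a))
        (trans (symm G c a) ac) (avoid-∷ c≢a (off-arc C∌c)))
      bc (avoid-∷ (c≢b ∘ sym) (avoid-∷ (a≢b ∘ sym) (off-arc C∌b))))
    (closing i d Bⱼ))

  weighted-disagreement : sum (λ i → 𝟙 (A i xor B i)) + 5 * sum (𝟙 ∘ A) + 3 * sum (𝟙 ∘ B) ≤ 4 * N
  weighted-disagreement = sum-xor+5A+3B≤4N A B d A-A-apart A-B-apart₁ A-B-apart₀

weighted⇒≤2000 : ∀ {D a a′ b b′ N j} → D + 5 * a + 3 * b ≤ 4 * N → a + a′ ≡ N → b + b′ ≡ N →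
  a′ < j → b′ < j → N + 502 ≡ 2 * j → D ≤ 2000
weighted⇒≤2000 {D} {a} {a′} {b} {b′} {N} {j} weighted a+a′≡N b+b′≡N a′<j b′<j N+502≡2j =
  +-cancelʳ-≤ (8 * N + 8) D 2000 (begin
    D + (8 * N + 8)                                  ≡⟨ cong (λ x → D + (x + 8)) 8N≡weights ⟩
    D + (5 * (a + a′) + 3 * (b + b′) + 8)            ≡⟨ regroup D a a′ b b′ ⟩
    (D + 5 * a + 3 * b) + (5 * suc a′ + 3 * suc b′)  ≤⟨ +-mono-≤ weighted weights≤8j ⟩
    4 * N + (5 * j + 3 * j)                          ≡⟨ cong (4 * N +_) 8j≡4[N+502] ⟩
    4 * N + 4 * (N + 502)                            ≡⟨ finish N ⟩
    2000 + (8 * N + 8)                               ∎)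
  where
  open ≤-Reasoning
  regroup : ∀ x y y′ z z′ →
    x + (5 * (y + y′) + 3 * (z + z′) + 8) ≡ (x + 5 * y + 3 * z) + (5 * suc y′ + 3 * suc z′)
  regroup = solve-∀
  finish : ∀ x → 4 * x + 4 * (x + 502) ≡ 2000 + (8 * x + 8)
  finish = solve-∀
  8x≡5x+3x : ∀ x → 8 * x ≡ 5 * x + 3 * x
  8x≡5x+3x = solve-∀
  5x+3x≡4[2x] : ∀ x → 5 * x + 3 * x ≡ 4 * (2 * x)
  5x+3x≡4[2x] = solve-∀
  weights≤8j : 5 * suc a′ + 3 * suc b′ ≤ 5 * j + 3 * j
  weights≤8j = +-mono-≤ (*-monoʳ-≤ 5 a′<j) (*-monoʳ-≤ 3 b′<j)
  8N≡weights : 8 * N ≡ 5 * (a + a′) + 3 * (b + b′)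
  8N≡weights = trans (8x≡5x+3x N) (cong₂ (λ x y → 5 * x + 3 * y) (sym a+a′≡N) (sym b+b′≡N))
  8j≡4[N+502] : 5 * j + 3 * j ≡ 4 * (N + 502)
  8j≡4[N+502] = trans (5x+3x≡4[2x] j) (cong (4 *_) (sym N+502≡2j))

module Lengths {j k : ℕ} (k+250<j : k + 250 < j) (2≤k : 2 ≤ k) where

  N d : ℕ
  N = 2 * j ∸ 502
  d = 2 * k ∸ 3

  private
    3≤2k : 3 ≤ 2 * k
    3≤2k = ≤-trans (n≤1+n 3) (*-monoʳ-≤ 2 2≤k)

    2k+502≤2j : 2 * k + 502 ≤ 2 * j
    2k+502≤2j = subst (_≤ 2 * j) (*-distribˡ-+ 2 k 251)
                      (*-monoʳ-≤ 2 (subst (_≤ j) (sym (+-suc k 250)) k+250<j))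

  N+502≡2j : N + 502 ≡ 2 * j
  N+502≡2j = m∸n+n≡m (≤-trans (m≤n+m 502 (2 * k)) 2k+502≤2j)

  d+2<N : 2 + d < N
  d+2<N = subst (_≤ N) (sym (m+[n∸m]≡n 3≤2k)) (m+n≤o⇒m≤o∸n (2 * k) 2k+502≤2j)

  4+d≡2k+1 : 4 + d ≡ 2 * k + 1
  4+d≡2k+1 = trans (cong suc (m+[n∸m]≡n 3≤2k)) (+-comm 1 (2 * k))

lemma24 : (j k : ℕ) → k + 250 < j → 2 * j < 3 * k → j ≥ 212299 → k ≥ 141534 →
    (G : Colouring (4 * j + 1)) →
    ¬ HasCycle G red (2 * k + 1) →
    ¬ HasWheel G blue (2 * j) →
    (v : Fin (4 * j + 1)) → (∀ w → blueDeg G w ≤ blueDeg G v) →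
    (a b : Fin (4 * j + 1)) → blueAdj G v a ≡ true → blueAdj G v b ≡ true →
    a ≢ b → col G a b ≡ red →
    blueDegIn G v a < j → blueDegIn G v b < j →
    (C : Fin (2 * j ∸ 502) → Fin (4 * j + 1)) → IsCycle G red (2 * j ∸ 502) C →
    (∀ i → blueAdj G v (C i) ≡ true) → (∀ i → C i ≢ a) → (∀ i → C i ≢ b) →
    (c : Fin (4 * j + 1)) → blueAdj G v c ≡ true → (∀ i → C i ≢ c) →
    c ≢ a → c ≢ b → col G a c ≡ red → col G b c ≡ red →
    count (λ i → differ (col G a (C i)) (col G b (C i))) ≤ 2000
lemma24 j k k+250<j _ _ k≥141534 G no-cycle _ v _ a b _ _ a≢b ab degᵃ<j degᵇ<j
        C C-cycle C⊆H C∌a C∌b c _ C∌c c≢a c≢b ac bc =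
  subst (_≤ 2000) (sym count≡sum-xor)
    (weighted⇒≤2000 weighted-disagreement (sum-𝟙+sum-𝟙-not A) (sum-𝟙+sum-𝟙-not B)
      (blue-count a C∌a degᵃ<j) (blue-count b C∌b degᵇ<j) N+502≡2j)
  where
  open Lengths k+250<j (≤-trans (s≤s (s≤s z≤n)) k≥141534)
  open OffCycleTriangle G d (subst (λ m → ¬ HasCycle G red m) (sym 4+d≡2k+1) no-cycle)
    C-cycle d+2<N C∌a C∌b C∌c a≢b c≢a c≢b ab ac bc
  count≡sum-xor : count (λ i → differ (col G a (C i)) (col G b (C i))) ≡ sum (λ i → 𝟙 (A i xor B i))
  count≡sum-xor = trans (count≡sum (λ i → differ (col G a (C i)) (col G b (C i))))
    (sum-cong-≗ (λ i → cong 𝟙 (differ≡xor (col G a (C i)) (col G b (C i)))))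
  blue-count : ∀ x → (∀ i → C i ≢ x) → blueDegIn G v x < j →
    sum (λ i → 𝟙 (not (isRed (col G x (C i))))) < j
  blue-count x C∌x deg<j = ≤-<-trans
    (≤-trans (≤-reflexive (sum-cong-≗ (λ i → cong 𝟙 (not-isRed (col G x (C i))))))
             (sum-blue-≤-blueDegIn G v x C (proj₁ C-cycle) C⊆H C∌x))
    deg<j
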